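{- For all processes $P,Q\in\mathcal P$: $P\sqsupseteq_{1}Q$ if and only if $P\sqsupseteq_{2}Q$; i.e. the strong 1-faster-than and strong 2-faster-than precongruences coincide.
   Context: TACS. Fix a countable set $\Lambda$ of action names; $\overline{\Lambda}=\{\overline a : a\in\Lambda\}$ with $\overline{\overline a}=a$; $\mathcal A=\Lambda\cup\overline\Lambda\cup\{\tau\}$ is the set of actions (ranged over by $\alpha$), and $a$ ranges over $\Lambda\cup\overline\Lambda$. Terms (set $\widehat{\mathcal P}$) are generated by $P::=\mathbf 0\mid x\mid \alpha.P\mid \sigma.P\mid P+P\mid P|P\mid P\backslash L\mid P[f]\mid \mu x.P$, where $x$ ranges over a countably infinite set of variables, $L\subseteq\mathcal A\setminus\{\tau\}$ is finite, and $f:\mathcal A\to\mathcal A$ satisfies $f(\tau)=\tau$, $f(\overline a)=\overline{f(a)}$ and $f(\alpha)\neq\alpha$ for only finitely many $\alpha$. $\mu x$ binds $x$; $P[Q/x]$ denotes substitution of $Q$ for the free occurrences of $x$. A variable is guarded in a term if each of its occurrences is in the scope of an action prefix $\alpha.\_$ (a $\sigma$-prefix does not count). In every term $\mu x.P$, $x$ must be guarded in $P$. Processes (set $\mathcal P$) are the closed terms. $\overline L=\{\overline a: a\in L\}$. Urgent sets: $\mathcal U(\sigma.P)=\mathcal U(\mathbf 0)=\mathcal U(x)=\emptyset$, $\mathcal U(\alpha.P)=\{\alpha\}$, $\mathcal U(P+Q)=\mathcal U(P)\cup\mathcal U(Q)$, $\mathcal U(P|Q)=\mathcal U(P)\cup\mathcal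 U(Q)\cup\{\tau\mid \mathcal U(P)\cap\overline{\mathcal U(Q)}\neq\emptyset\}$, $\mathcal U(P\backslash L)=\mathcal U(P)\setminus(L\cup\overline L)$, $\mathcal U(P[f])=\{f(\alpha):\alpha\in\mathcal U(P)\}$, $\mathcal U(\mu x.P)=\mathcal U(P)$. Action transitions $\xrightarrow{\alpha}$ are the least relations with: $\alpha.P\xrightarrow{\alpha}P$; if $P\xrightarrow{\alpha}P'$ then $\sigma.P\xrightarrow{\alpha}P'$, $\mu x.P\xrightarrow{\alpha}P'[\mu x.P/x]$, $P+Q\xrightarrow{\alpha}P'$, $Q+P\xrightarrow{\alpha}P'$, $P|Q\xrightarrow{\alpha}P'|Q$, $Q|P\xrightarrow{\alpha}Q|P'$, $P[f]\xrightarrow{f(\alpha)}P'[f]$, and $P\backslash L\xrightarrow{\alpha}P'\backslash L$ if $\alpha\notin L\cup\overline L$; if $P\xrightarrow{a}P'$ and $Q\xrightarrow{\overline a}Q'$ then $P|Q\xrightarrow{\tau}P'|Q'$. Clock transitions $\xrightarrow{\sigma}_i$ ($i\in\{1,2\}$) are the least relations with: $\mathbf 0\xrightarrow{\sigma}_i\mathbf 0$; $a.P\xrightarrow{\sigma}_i a.P$ for $a\in\Lambda\cup\overline\Lambda$; $\sigma.P\xrightarrow{\sigma}_iP$; if $P\xrightarrow{\sigma}_iP'$ then $\mu x.P\xrightarrow{\sigma}_iP'[\mu x.P/x]$, $P\backslash L\xrightarrow{\sigma}_iP'\backslash L$, $P[f]\xrightarrow{\sigma}_iP'[f]$; if $P\xrightarrow{\sigma}_iP'$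 and $Q\xrightarrow{\sigma}_iQ'$ then $P+Q\xrightarrow{\sigma}_iP'+Q'$, and $P|Q\xrightarrow{\sigma}_iP'|Q'$ provided $\tau\notin\mathcal U(P|Q)$; and, only for $i=2$: if $P\xrightarrow{\sigma}_2P'$ then $\sigma.P\xrightarrow{\sigma}_2P'$. For $i\in\{1,2\}$, $\mathcal R\subseteq\mathcal P\times\mathcal P$ is a strong i-faster-than relation if for all $(P,Q)\in\mathcal R$, $\alpha\in\mathcal A$: (1) $P\xrightarrow{\alpha}P'$ implies $\exists Q'$. $Q\xrightarrow{\alpha}Q'$, $(P',Q')\in\mathcal R$; (2) $Q\xrightarrow{\alpha}Q'$ implies $\exists P'$. $P\xrightarrow{\alpha}P'$, $(P',Q')\in\mathcal R$; (3) $P\xrightarrow{\sigma}_iP'$ implies $\mathcal U(Q)\subseteq\mathcal U(P)$ and $\exists Q'$. $Q\xrightarrow{\sigma}_iQ'$, $(P',Q')\in\mathcal R$. $P\sqsupseteq_iQ$ iff $(P,Q)$ lies in some strong i-faster-than relation. -}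

module Defs where

open import Data.Nat using (ℕ; zero; suc)
open import Data.Fin using (Fin; zero; suc)
open import Data.List using (List)
open import Data.List.Membership.Propositional using (_∈_; _∉_)
open import Data.Product using (Σ; ∃; _×_; proj₁)
open import Data.Sum using (_⊎_)
open import Data.Unit using (⊤)
open import Data.Empty using (⊥)
open import Relation.Nullary using (¬_)
open import Relation.Binary.PropositionalEquality using (_≡_; _≢_)

data Lab : Set where
  nm : ℕ → Lab
  co : ℕ → Lab

bar : Lab → Lab
bar (nm n) = co n
bar (co n) = nm n

data Act : Set where
  act : Lab → Act
  τ   : Act

-- Since overline is only defined on
-- visible actions, f maps visible actions to visible actions.
record Relabel : Set where
  field
    fn      : Lab → Lab
    fn-bar  : ∀ a → fn (bar a) ≡ bar (fn a)
    support : List Lab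
    finite  : ∀ a → a ∉ support → fn a ≡ a

relabel : Relabel → Act → Act
relabel f (act a) = act (Relabel.fn f a)
relabel f τ       = τ

InL : Act → List Lab → Set
InL (act a) L = (a ∈ L) ⊎ (bar a ∈ L)
InL τ       L = ⊥

-- Terms, with well-scoped de Bruijn variables (Term n has n free variables).

infixr 20 _∙_
infixr 20 σ∙_
infixl 10 _⊕_
infixl 9  _∥_

data Term (n : ℕ) : Set where
  𝟎     : Term n
  var   : Fin n → Term n
  _∙_   : Act → Term n → Term n
  σ∙_   : Term n → Term n
  _⊕_   : Term n → Term n → Term n
  _∥_   : Term n → Term n → Term n
  _∖_   : Term n → List Lab → Term n
  _[_]ʳ : Term n → Relabel → Term n
  μ     : Term (suc n) → Term n

ext : ∀ {m n} → (Fin m → Fin n) → Fin (suc m) → Fin (suc n)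
ext ρ zero    = zero
ext ρ (suc i) = suc (ρ i)

ren : ∀ {m n} → (Fin m → Fin n) → Term m → Term n
ren ρ 𝟎         = 𝟎
ren ρ (var i)   = var (ρ i)
ren ρ (α ∙ P)   = α ∙ ren ρ P
ren ρ (σ∙ P)    = σ∙ ren ρ P
ren ρ (P ⊕ Q)   = ren ρ P ⊕ ren ρ Q
ren ρ (P ∥ Q)   = ren ρ P ∥ ren ρ Q
ren ρ (P ∖ L)   = ren ρ P ∖ L
ren ρ (P [ f ]ʳ) = ren ρ P [ f ]ʳ
ren ρ (μ P)     = μ (ren (ext ρ) P)

exts : ∀ {m n} → (Fin m → Term n) → Fin (suc m) → Term (suc n)
exts s zero    = var zero
exts s (suc i) = ren suc (s i)

sub : ∀ {m n} → (Fin m → Term n) → Term m → Term n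
sub s 𝟎         = 𝟎
sub s (var i)   = s i
sub s (α ∙ P)   = α ∙ sub s P
sub s (σ∙ P)    = σ∙ sub s P
sub s (P ⊕ Q)   = sub s P ⊕ sub s Q
sub s (P ∥ Q)   = sub s P ∥ sub s Q
sub s (P ∖ L)   = sub s P ∖ L
sub s (P [ f ]ʳ) = sub s P [ f ]ʳ
sub s (μ P)     = μ (sub (exts s) P)

single : ∀ {n} → Term n → Fin (suc n) → Term n
single Q zero    = Q
single Q (suc i) = var i

_[_/0] : ∀ {n} → Term (suc n) → Term n → Term n
P [ Q /0] = sub (single Q) P

Guarded : ∀ {n} → Fin n → Term n → Set
Guarded i 𝟎          = ⊤
Guarded i (var j)    = j ≢ i
Guarded i (α ∙ P)    = ⊤
Guarded i (σ∙ P)     = Guarded i P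
Guarded i (P ⊕ Q)    = Guarded i P × Guarded i Q
Guarded i (P ∥ Q)    = Guarded i P × Guarded i Q
Guarded i (P ∖ L)    = Guarded i P
Guarded i (P [ f ]ʳ) = Guarded i P
Guarded i (μ P)      = Guarded (suc i) P

WF : ∀ {n} → Term n → Set
WF 𝟎          = ⊤
WF (var j)    = ⊤
WF (α ∙ P)    = WF P
WF (σ∙ P)     = WF P
WF (P ⊕ Q)    = WF P × WF Q
WF (P ∥ Q)    = WF P × WF Q
WF (P ∖ L)    = WF P
WF (P [ f ]ʳ) = WF P
WF (μ P)      = Guarded zero P × WF P

Proc : Set
Proc = Σ (Term 0) WF

data _∈U_ {n : ℕ} : Act → Term n → Set where
  u-pre : ∀ {α P} → α ∈U (α ∙ P)
  u-+l  : ∀ {α P Q} → α ∈U P → α ∈U (P ⊕ Q)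
  u-+r  : ∀ {α P Q} → α ∈U Q → α ∈U (P ⊕ Q)
  u-∥l  : ∀ {α P Q} → α ∈U P → α ∈U (P ∥ Q)
  u-∥r  : ∀ {α P Q} → α ∈U Q → α ∈U (P ∥ Q)
  u-∥τ  : ∀ {P Q} (a : Lab) → act a ∈U P → act (bar a) ∈U Q → τ ∈U (P ∥ Q)
  u-∖   : ∀ {α P L} → α ∈U P → ¬ InL α L → α ∈U (P ∖ L)
  u-rel : ∀ {α P f} → α ∈U P → relabel f α ∈U (P [ f ]ʳ)
  u-μ   : ∀ {α P} → α ∈U P → α ∈U (μ P)

data _—[_]→_ {n : ℕ} : Term n → Act → Term n → Set where
  a-pre  : ∀ {α P} → (α ∙ P) —[ α ]→ P
  a-σ    : ∀ {α P P'} → P —[ α ]→ P' → (σ∙ P) —[ α ]→ P'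
  a-μ    : ∀ {α P P'} → P —[ α ]→ P' → μ P —[ α ]→ (P' [ μ P /0])
  a-+l   : ∀ {α P P' Q} → P —[ α ]→ P' → (P ⊕ Q) —[ α ]→ P'
  a-+r   : ∀ {α P P' Q} → P —[ α ]→ P' → (Q ⊕ P) —[ α ]→ P'
  a-∥l   : ∀ {α P P' Q} → P —[ α ]→ P' → (P ∥ Q) —[ α ]→ (P' ∥ Q)
  a-∥r   : ∀ {α P P' Q} → P —[ α ]→ P' → (Q ∥ P) —[ α ]→ (Q ∥ P')
  a-rel  : ∀ {α P P' f} → P —[ α ]→ P' → (P [ f ]ʳ) —[ relabel f α ]→ (P' [ f ]ʳ)
  a-∖    : ∀ {α P P' L} → P —[ α ]→ P' → ¬ InL α L → (P ∖ L) —[ α ]→ (P' ∖ L)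
  a-sync : ∀ {a P P' Q Q'} → P —[ act a ]→ P' → Q —[ act (bar a) ]→ Q'
         → (P ∥ Q) —[ τ ]→ (P' ∥ Q')

data Idx : Set where
  one two : Idx

data Clock {n : ℕ} : Idx → Term n → Term n → Set where
  c-0   : ∀ {i} → Clock i 𝟎 𝟎
  c-pre : ∀ {i P} (a : Lab) → Clock i (act a ∙ P) (act a ∙ P)
  c-σ   : ∀ {i P} → Clock i (σ∙ P) P
  c-μ   : ∀ {i P P'} → Clock i P P' → Clock i (μ P) (P' [ μ P /0])
  c-∖   : ∀ {i P P' L} → Clock i P P' → Clock i (P ∖ L) (P' ∖ L)
  c-rel : ∀ {i P P' f} → Clock i P P' → Clock i (P [ f ]ʳ) (P' [ f ]ʳ)
  c-+   : ∀ {i P P' Q Q'} → Clock i P P' → Clock i Q Q' → Clock i (P ⊕ Q) (P' ⊕ Q')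
  c-∥   : ∀ {i P P' Q Q'} → Clock i P P' → Clock i Q Q' → ¬ (τ ∈U (P ∥ Q))
        → Clock i (P ∥ Q) (P' ∥ Q')
  c-σ₂  : ∀ {P P'} → Clock two P P' → Clock two (σ∙ P) P'

IsFasterThan : Idx → (Proc → Proc → Set) → Set
IsFasterThan i R = ∀ (P Q : Proc) → R P Q →
    (∀ (α : Act) (P' : Proc) → proj₁ P —[ α ]→ proj₁ P' →
       ∃ λ (Q' : Proc) → (proj₁ Q —[ α ]→ proj₁ Q') × R P' Q')
  × (∀ (α : Act) (Q' : Proc) → proj₁ Q —[ α ]→ proj₁ Q' →
       ∃ λ (P' : Proc) → (proj₁ P —[ α ]→ proj₁ P') × R P' Q')
  × (∀ (P' : Proc) → Clock i (proj₁ P) (proj₁ P') →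
       (∀ (α : Act) → α ∈U proj₁ Q → α ∈U proj₁ P)
       × ∃ λ (Q' : Proc) → Clock i (proj₁ Q) (proj₁ Q') × R P' Q')

_⊒[_]_ : Proc → Idx → Proc → Set₁
P ⊒[ i ] Q = ∃ λ (R : Proc → Proc → Set) → IsFasterThan i R × R P Q

-- Every σ₁-step is a σ₂-step. Conversely, a σ₂-step P —σ→₂ P' is matched by the
-- σ₁-step P —σ→₁ P₁ that removes only the outermost σ-prefixes, and P' is P₁ with
-- some further ticks elapsed in its parallel components. Call X ahead of Y if X
-- arises from Y in this way: the least relation containing the reversed σ₂-steps
-- that is reflexive, transitive and closed under +, |, \L and [f]. Since a tick
-- neither enables nor disables an action and keeps every urgent action, "ahead" is a
-- strong 2-faster-than relation. Hence if R is a strong 1-faster-than relation then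
-- (ahead ⨾ R) is a strong 2-faster-than relation, and if R is a strong 2-faster-than
-- relation then (R ⨾ ahead) is a strong 1-faster-than relation.
module Submission where

open import Defs
open import Data.Empty using (⊥-elim)
open import Data.Fin using (Fin; zero; suc)
open import Data.Fin.Properties using (suc-injective)
open import Data.Nat using (suc)
open import Data.Product using (_×_; ∃; _,_; proj₁; proj₂)
open import Data.Unit using (tt)
open import Function using (_∘_)
open import Relation.Binary.PropositionalEquality

ext-cong : ∀ {m n} {ρ ρ' : Fin m → Fin n} → ρ ≗ ρ' → ext ρ ≗ ext ρ'
ext-cong eq zero    = refl
ext-cong eq (suc i) = cong suc (eq i)

ren-cong : ∀ {m n} {ρ ρ' : Fin m → Fin n} → ρ ≗ ρ' → ren ρ ≗ ren ρ'
ren-cong eq 𝟎          = refl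
ren-cong eq (var i)    = cong var (eq i)
ren-cong eq (α ∙ P)    = cong (α ∙_) (ren-cong eq P)
ren-cong eq (σ∙ P)     = cong σ∙_ (ren-cong eq P)
ren-cong eq (P ⊕ Q)    = cong₂ _⊕_ (ren-cong eq P) (ren-cong eq Q)
ren-cong eq (P ∥ Q)    = cong₂ _∥_ (ren-cong eq P) (ren-cong eq Q)
ren-cong eq (P ∖ L)    = cong (_∖ L) (ren-cong eq P)
ren-cong eq (P [ f ]ʳ) = cong (_[ f ]ʳ) (ren-cong eq P)
ren-cong eq (μ P)      = cong μ (ren-cong (ext-cong eq) P)

exts-cong : ∀ {m n} {s s' : Fin m → Term n} → s ≗ s' → exts s ≗ exts s'
exts-cong eq zero    = refl
exts-cong eq (suc i) = cong (ren suc) (eq i)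

sub-cong : ∀ {m n} {s s' : Fin m → Term n} → s ≗ s' → sub s ≗ sub s'
sub-cong eq 𝟎          = refl
sub-cong eq (var i)    = eq i
sub-cong eq (α ∙ P)    = cong (α ∙_) (sub-cong eq P)
sub-cong eq (σ∙ P)     = cong σ∙_ (sub-cong eq P)
sub-cong eq (P ⊕ Q)    = cong₂ _⊕_ (sub-cong eq P) (sub-cong eq Q)
sub-cong eq (P ∥ Q)    = cong₂ _∥_ (sub-cong eq P) (sub-cong eq Q)
sub-cong eq (P ∖ L)    = cong (_∖ L) (sub-cong eq P)
sub-cong eq (P [ f ]ʳ) = cong (_[ f ]ʳ) (sub-cong eq P)
sub-cong eq (μ P)      = cong μ (sub-cong (exts-cong eq) P)

ren-ren : ∀ {l m n} (ρ : Fin m → Fin n) (ρ' : Fin l → Fin m) → ren ρ ∘ ren ρ' ≗ ren (ρ ∘ ρ')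
ren-ren ρ ρ' 𝟎          = refl
ren-ren ρ ρ' (var i)    = refl
ren-ren ρ ρ' (α ∙ P)    = cong (α ∙_) (ren-ren ρ ρ' P)
ren-ren ρ ρ' (σ∙ P)     = cong σ∙_ (ren-ren ρ ρ' P)
ren-ren ρ ρ' (P ⊕ Q)    = cong₂ _⊕_ (ren-ren ρ ρ' P) (ren-ren ρ ρ' Q)
ren-ren ρ ρ' (P ∥ Q)    = cong₂ _∥_ (ren-ren ρ ρ' P) (ren-ren ρ ρ' Q)
ren-ren ρ ρ' (P ∖ L)    = cong (_∖ L) (ren-ren ρ ρ' P)
ren-ren ρ ρ' (P [ f ]ʳ) = cong (_[ f ]ʳ) (ren-ren ρ ρ' P)
ren-ren ρ ρ' (μ P)      = cong μ (trans (ren-ren (ext ρ) (ext ρ') P) (ren-cong ext-∘ P))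
  where
  ext-∘ : ext ρ ∘ ext ρ' ≗ ext (ρ ∘ ρ')
  ext-∘ zero    = refl
  ext-∘ (suc i) = refl

sub-ren : ∀ {l m n} (s : Fin m → Term n) (ρ : Fin l → Fin m) → sub s ∘ ren ρ ≗ sub (s ∘ ρ)
sub-ren s ρ 𝟎          = refl
sub-ren s ρ (var i)    = refl
sub-ren s ρ (α ∙ P)    = cong (α ∙_) (sub-ren s ρ P)
sub-ren s ρ (σ∙ P)     = cong σ∙_ (sub-ren s ρ P)
sub-ren s ρ (P ⊕ Q)    = cong₂ _⊕_ (sub-ren s ρ P) (sub-ren s ρ Q)
sub-ren s ρ (P ∥ Q)    = cong₂ _∥_ (sub-ren s ρ P) (sub-ren s ρ Q)
sub-ren s ρ (P ∖ L)    = cong (_∖ L) (sub-ren s ρ P)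
sub-ren s ρ (P [ f ]ʳ) = cong (_[ f ]ʳ) (sub-ren s ρ P)
sub-ren s ρ (μ P)      = cong μ (trans (sub-ren (exts s) (ext ρ) P) (sub-cong exts-ext P))
  where
  exts-ext : exts s ∘ ext ρ ≗ exts (s ∘ ρ)
  exts-ext zero    = refl
  exts-ext (suc i) = refl

ren-sub : ∀ {l m n} (ρ : Fin m → Fin n) (s : Fin l → Term m) → ren ρ ∘ sub s ≗ sub (ren ρ ∘ s)
ren-sub ρ s 𝟎          = refl
ren-sub ρ s (var i)    = refl
ren-sub ρ s (α ∙ P)    = cong (α ∙_) (ren-sub ρ s P)
ren-sub ρ s (σ∙ P)     = cong σ∙_ (ren-sub ρ s P)
ren-sub ρ s (P ⊕ Q)    = cong₂ _⊕_ (ren-sub ρ s P) (ren-sub ρ s Q)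
ren-sub ρ s (P ∥ Q)    = cong₂ _∥_ (ren-sub ρ s P) (ren-sub ρ s Q)
ren-sub ρ s (P ∖ L)    = cong (_∖ L) (ren-sub ρ s P)
ren-sub ρ s (P [ f ]ʳ) = cong (_[ f ]ʳ) (ren-sub ρ s P)
ren-sub ρ s (μ P)      = cong μ (trans (ren-sub (ext ρ) (exts s) P) (sub-cong ext-exts P))
  where
  ext-exts : ren (ext ρ) ∘ exts s ≗ exts (ren ρ ∘ s)
  ext-exts zero    = refl
  ext-exts (suc i) = trans (ren-ren (ext ρ) suc (s i)) (sym (ren-ren suc ρ (s i)))

sub-sub : ∀ {l m n} (s : Fin m → Term n) (u : Fin l → Term m) → sub s ∘ sub u ≗ sub (sub s ∘ u)
sub-sub s u 𝟎          = refl
sub-sub s u (var i)    = refl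
sub-sub s u (α ∙ P)    = cong (α ∙_) (sub-sub s u P)
sub-sub s u (σ∙ P)     = cong σ∙_ (sub-sub s u P)
sub-sub s u (P ⊕ Q)    = cong₂ _⊕_ (sub-sub s u P) (sub-sub s u Q)
sub-sub s u (P ∥ Q)    = cong₂ _∥_ (sub-sub s u P) (sub-sub s u Q)
sub-sub s u (P ∖ L)    = cong (_∖ L) (sub-sub s u P)
sub-sub s u (P [ f ]ʳ) = cong (_[ f ]ʳ) (sub-sub s u P)
sub-sub s u (μ P)      = cong μ (trans (sub-sub (exts s) (exts u) P) (sub-cong exts-exts P))
  where
  exts-exts : sub (exts s) ∘ exts u ≗ exts (sub s ∘ u)
  exts-exts zero    = refl
  exts-exts (suc i) = trans (sub-ren (exts s) suc (u i)) (sym (ren-sub suc s (u i)))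

sub-id : ∀ {n} → sub {n} var ≗ (λ P → P)
sub-id 𝟎          = refl
sub-id (var i)    = refl
sub-id (α ∙ P)    = cong (α ∙_) (sub-id P)
sub-id (σ∙ P)     = cong σ∙_ (sub-id P)
sub-id (P ⊕ Q)    = cong₂ _⊕_ (sub-id P) (sub-id Q)
sub-id (P ∥ Q)    = cong₂ _∥_ (sub-id P) (sub-id Q)
sub-id (P ∖ L)    = cong (_∖ L) (sub-id P)
sub-id (P [ f ]ʳ) = cong (_[ f ]ʳ) (sub-id P)
sub-id (μ P)      = cong μ (trans (sub-cong exts-var P) (sub-id P))
  where
  exts-var : exts var ≗ var
  exts-var zero    = refl
  exts-var (suc i) = refl

sub-single : ∀ {m n} (s : Fin m → Term n) P Q → sub (sub s ∘ single Q) P ≡ sub (exts s) P [ sub s Q /0]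
sub-single s P Q = trans (sub-cong single-exts P) (sym (sub-sub (single (sub s Q)) (exts s) P))
  where
  single-exts : sub s ∘ single Q ≗ sub (single (sub s Q)) ∘ exts s
  single-exts zero    = refl
  single-exts (suc i) = sym (trans (sub-ren (single (sub s Q)) suc (s i)) (sub-id (s i)))

sub-[/0] : ∀ {m n} (s : Fin m → Term n) P Q → sub s (P [ Q /0]) ≡ sub (exts s) P [ sub s Q /0]
sub-[/0] s P Q = trans (sub-sub s (single Q) P) (sub-single s P Q)

AllGuarded : ∀ {n} → Term n → Set
AllGuarded P = ∀ i → Guarded i P

μ-body-guarded : ∀ {n} (P : Term (suc n)) → Guarded zero P → AllGuarded (μ P) → AllGuarded P
μ-body-guarded P g₀ g zero    = g₀
μ-body-guarded P g₀ g (suc i) = g i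

guarded-ren-fresh : ∀ {m n} (ρ : Fin m → Fin n) {k} → (∀ j → ρ j ≢ k) → ∀ P → Guarded k (ren ρ P)
guarded-ren-fresh ρ fresh 𝟎          = tt
guarded-ren-fresh ρ fresh (var j)    = fresh j
guarded-ren-fresh ρ fresh (α ∙ P)    = tt
guarded-ren-fresh ρ fresh (σ∙ P)     = guarded-ren-fresh ρ fresh P
guarded-ren-fresh ρ fresh (P ⊕ Q)    = guarded-ren-fresh ρ fresh P , guarded-ren-fresh ρ fresh Q
guarded-ren-fresh ρ fresh (P ∥ Q)    = guarded-ren-fresh ρ fresh P , guarded-ren-fresh ρ fresh Q
guarded-ren-fresh ρ fresh (P ∖ L)    = guarded-ren-fresh ρ fresh P
guarded-ren-fresh ρ fresh (P [ f ]ʳ) = guarded-ren-fresh ρ fresh P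
guarded-ren-fresh ρ fresh (μ P)      = guarded-ren-fresh (ext ρ) ext-fresh P
  where
  ext-fresh : ∀ j → ext ρ j ≢ suc _
  ext-fresh zero    ()
  ext-fresh (suc j) eq = fresh j (suc-injective eq)

guarded-ren : ∀ {m n} (ρ : Fin m → Fin n) {k k'} → (∀ j → j ≢ k → ρ j ≢ k')
            → ∀ P → Guarded k P → Guarded k' (ren ρ P)
guarded-ren ρ ρ-k 𝟎          g        = tt
guarded-ren ρ ρ-k (var j)    g        = ρ-k j g
guarded-ren ρ ρ-k (α ∙ P)    g        = tt
guarded-ren ρ ρ-k (σ∙ P)     g        = guarded-ren ρ ρ-k P g
guarded-ren ρ ρ-k (P ⊕ Q)    (g , g') = guarded-ren ρ ρ-k P g , guarded-ren ρ ρ-k Q g'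
guarded-ren ρ ρ-k (P ∥ Q)    (g , g') = guarded-ren ρ ρ-k P g , guarded-ren ρ ρ-k Q g'
guarded-ren ρ ρ-k (P ∖ L)    g        = guarded-ren ρ ρ-k P g
guarded-ren ρ ρ-k (P [ f ]ʳ) g        = guarded-ren ρ ρ-k P g
guarded-ren ρ ρ-k (μ P)      g        = guarded-ren (ext ρ) ext-k P g
  where
  ext-k : ∀ j → j ≢ suc _ → ext ρ j ≢ suc _
  ext-k zero    _   ()
  ext-k (suc j) j≢k eq = ρ-k j (j≢k ∘ cong suc) (suc-injective eq)

wf-ren : ∀ {m n} (ρ : Fin m → Fin n) P → WF P → WF (ren ρ P)
wf-ren ρ 𝟎          w        = tt
wf-ren ρ (var j)    w        = tt
wf-ren ρ (α ∙ P)    w        = wf-ren ρ P w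
wf-ren ρ (σ∙ P)     w        = wf-ren ρ P w
wf-ren ρ (P ⊕ Q)    (w , w') = wf-ren ρ P w , wf-ren ρ Q w'
wf-ren ρ (P ∥ Q)    (w , w') = wf-ren ρ P w , wf-ren ρ Q w'
wf-ren ρ (P ∖ L)    w        = wf-ren ρ P w
wf-ren ρ (P [ f ]ʳ) w        = wf-ren ρ P w
wf-ren ρ (μ P)      (g₀ , w) = guarded-ren (ext ρ) ext-0 P g₀ , wf-ren (ext ρ) P w
  where
  ext-0 : ∀ j → j ≢ zero → ext ρ j ≢ zero
  ext-0 zero    j≢0 = ⊥-elim (j≢0 refl)
  ext-0 (suc j) _   ()

guarded-sub : ∀ {m n} (s : Fin m → Term n) {k k'} P → (∀ j → j ≢ k → Guarded k' (s j))
            → Guarded k P → Guarded k' (sub s P)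
guarded-sub s 𝟎          s-k g        = tt
guarded-sub s (var j)    s-k g        = s-k j g
guarded-sub s (α ∙ P)    s-k g        = tt
guarded-sub s (σ∙ P)     s-k g        = guarded-sub s P s-k g
guarded-sub s (P ⊕ Q)    s-k (g , g') = guarded-sub s P s-k g , guarded-sub s Q s-k g'
guarded-sub s (P ∥ Q)    s-k (g , g') = guarded-sub s P s-k g , guarded-sub s Q s-k g'
guarded-sub s (P ∖ L)    s-k g        = guarded-sub s P s-k g
guarded-sub s (P [ f ]ʳ) s-k g        = guarded-sub s P s-k g
guarded-sub s (μ P)      s-k g        = guarded-sub (exts s) P exts-k g
  where
  exts-k : ∀ j → j ≢ suc _ → Guarded (suc _) (exts s j)
  exts-k zero    _   ()
  exts-k (suc j) j≢k = guarded-ren suc (λ _ i≢k → i≢k ∘ suc-injective) (s j) (s-k j (j≢k ∘ cong suc))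

wf-sub : ∀ {m n} (s : Fin m → Term n) P → (∀ i → WF (s i)) → WF P → WF (sub s P)
wf-sub s 𝟎          ws w        = tt
wf-sub s (var j)    ws w        = ws j
wf-sub s (α ∙ P)    ws w        = wf-sub s P ws w
wf-sub s (σ∙ P)     ws w        = wf-sub s P ws w
wf-sub s (P ⊕ Q)    ws (w , w') = wf-sub s P ws w , wf-sub s Q ws w'
wf-sub s (P ∥ Q)    ws (w , w') = wf-sub s P ws w , wf-sub s Q ws w'
wf-sub s (P ∖ L)    ws w        = wf-sub s P ws w
wf-sub s (P [ f ]ʳ) ws w        = wf-sub s P ws w
wf-sub s (μ P)      ws (g₀ , w) = guarded-sub (exts s) P exts-0 g₀ , wf-sub (exts s) P wf-exts w
  where
  exts-0 : ∀ j → j ≢ zero → Guarded zero (exts s j)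
  exts-0 zero    j≢0 = ⊥-elim (j≢0 refl)
  exts-0 (suc j) _   = guarded-ren-fresh suc (λ _ ()) (s j)
  wf-exts : ∀ i → WF (exts s i)
  wf-exts zero    = tt
  wf-exts (suc i) = wf-ren suc (s i) (ws i)

wf-single : ∀ {n} {Q : Term n} → WF Q → ∀ i → WF (single Q i)
wf-single w zero    = w
wf-single w (suc i) = tt

wf-unfold : ∀ {n} {P : Term (suc n)} P' → WF (μ P) → WF P' → WF (P' [ μ P /0])
wf-unfold P' w w' = wf-sub _ P' (wf-single w) w'

wf-act : ∀ {n} {P P' : Term n} {α} → WF P → P —[ α ]→ P' → WF P'
wf-act w        a-pre         = w
wf-act w        (a-σ t)       = wf-act w t
wf-act (g₀ , w) (a-μ {P' = P'} t) = wf-unfold P' (g₀ , w) (wf-act w t)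
wf-act (w , w') (a-+l t)      = wf-act w t
wf-act (w , w') (a-+r t)      = wf-act w' t
wf-act (w , w') (a-∥l t)      = wf-act w t , w'
wf-act (w , w') (a-∥r t)      = w , wf-act w' t
wf-act w        (a-rel t)     = wf-act w t
wf-act w        (a-∖ t _)     = wf-act w t
wf-act (w , w') (a-sync t t') = wf-act w t , wf-act w' t'

wf-clock : ∀ {n i} {P P' : Term n} → WF P → Clock i P P' → WF P'
wf-clock w        c-0          = tt
wf-clock w        (c-pre a)    = w
wf-clock w        c-σ          = w
wf-clock w        (c-σ₂ k)     = wf-clock w k
wf-clock (g₀ , w) (c-μ {P' = P'} k) = wf-unfold P' (g₀ , w) (wf-clock w k)
wf-clock w        (c-∖ k)      = wf-clock w k
wf-clock w        (c-rel k)    = wf-clock w k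
wf-clock (w , w') (c-+ k k')   = wf-clock w k , wf-clock w' k'
wf-clock (w , w') (c-∥ k k' _) = wf-clock w k , wf-clock w' k'

_⊆ᵘ_ : ∀ {n} → Term n → Term n → Set
P ⊆ᵘ Q = ∀ (α : Act) → α ∈U P → α ∈U Q

act-sub : ∀ {m n} (s : Fin m → Term n) {P P' : Term m} {α} → P —[ α ]→ P' → sub s P —[ α ]→ sub s P'
act-sub s a-pre         = a-pre
act-sub s (a-σ t)       = a-σ (act-sub s t)
act-sub s (a-μ {α} {P} {P'} t) =
  subst (μ (sub (exts s) P) —[ α ]→_) (sym (sub-[/0] s P' (μ P))) (a-μ (act-sub (exts s) t))
act-sub s (a-+l t)      = a-+l (act-sub s t)
act-sub s (a-+r t)      = a-+r (act-sub s t)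
act-sub s (a-∥l t)      = a-∥l (act-sub s t)
act-sub s (a-∥r t)      = a-∥r (act-sub s t)
act-sub s (a-rel t)     = a-rel (act-sub s t)
act-sub s (a-∖ t α∉L)   = a-∖ (act-sub s t) α∉L
act-sub s (a-sync t t') = a-sync (act-sub s t) (act-sub s t')

act-sub⁻ : ∀ {m n} (s : Fin m → Term n) P → WF P → AllGuarded P → ∀ {α W} → sub s P —[ α ]→ W
         → ∃ λ P' → (P —[ α ]→ P') × W ≡ sub s P'
act-sub⁻ s 𝟎          w        g ()
act-sub⁻ s (var i)    w        g t             = ⊥-elim (g i refl)
act-sub⁻ s (α ∙ P)    w        g a-pre         = P , a-pre , refl
act-sub⁻ s (σ∙ P)     w        g (a-σ t)       with act-sub⁻ s P w g t
... | P' , t' , eq = P' , a-σ t' , eq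
act-sub⁻ s (P ⊕ Q)    (w , w') g (a-+l t)      with act-sub⁻ s P w (proj₁ ∘ g) t
... | P' , t' , eq = P' , a-+l t' , eq
act-sub⁻ s (P ⊕ Q)    (w , w') g (a-+r t)      with act-sub⁻ s Q w' (proj₂ ∘ g) t
... | Q' , t' , eq = Q' , a-+r t' , eq
act-sub⁻ s (P ∥ Q)    (w , w') g (a-∥l t)      with act-sub⁻ s P w (proj₁ ∘ g) t
... | P' , t' , eq = P' ∥ Q , a-∥l t' , cong (_∥ sub s Q) eq
act-sub⁻ s (P ∥ Q)    (w , w') g (a-∥r t)      with act-sub⁻ s Q w' (proj₂ ∘ g) t
... | Q' , t' , eq = P ∥ Q' , a-∥r t' , cong (sub s P ∥_) eq
act-sub⁻ s (P ∥ Q)    (w , w') g (a-sync t u)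
  with act-sub⁻ s P w (proj₁ ∘ g) t | act-sub⁻ s Q w' (proj₂ ∘ g) u
... | P' , t' , eq | Q' , u' , eq' = P' ∥ Q' , a-sync t' u' , cong₂ _∥_ eq eq'
act-sub⁻ s (P ∖ L)    w        g (a-∖ t α∉L)   with act-sub⁻ s P w g t
... | P' , t' , eq = P' ∖ L , a-∖ t' α∉L , cong (_∖ L) eq
act-sub⁻ s (P [ f ]ʳ) w        g (a-rel t)     with act-sub⁻ s P w g t
... | P' , t' , eq = P' [ f ]ʳ , a-rel t' , cong (_[ f ]ʳ) eq
act-sub⁻ s (μ P)      (g₀ , w) g (a-μ t)       with act-sub⁻ (exts s) P w (μ-body-guarded P g₀ g) t
... | P' , t' , eq = P' [ μ P /0] , a-μ t' ,
  trans (cong (_[ μ (sub (exts s) P) /0]) eq) (sym (sub-[/0] s P' (μ P)))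

μ-unfold-act : ∀ {n} {P : Term (suc n)} {α W} → WF (μ P) → AllGuarded (μ P)
             → (P [ μ P /0]) —[ α ]→ W → μ P —[ α ]→ W
μ-unfold-act {P = P} (g₀ , w) g t with act-sub⁻ (single (μ P)) P w (μ-body-guarded P g₀ g) t
... | P' , t' , refl = a-μ t'

μ-unfold-act⁻ : ∀ {n} {P : Term (suc n)} {α W} → μ P —[ α ]→ W → (P [ μ P /0]) —[ α ]→ W
μ-unfold-act⁻ {P = P} (a-μ t) = act-sub (single (μ P)) t

urgent-sub : ∀ {m n} (s : Fin m → Term n) {P : Term m} {α} → α ∈U P → α ∈U sub s P
urgent-sub s u-pre         = u-pre
urgent-sub s (u-+l u)      = u-+l (urgent-sub s u)
urgent-sub s (u-+r u)      = u-+r (urgent-sub s u)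
urgent-sub s (u-∥l u)      = u-∥l (urgent-sub s u)
urgent-sub s (u-∥r u)      = u-∥r (urgent-sub s u)
urgent-sub s (u-∥τ a u u') = u-∥τ a (urgent-sub s u) (urgent-sub s u')
urgent-sub s (u-∖ u α∉L)   = u-∖ (urgent-sub s u) α∉L
urgent-sub s (u-rel u)     = u-rel (urgent-sub s u)
urgent-sub s (u-μ u)       = u-μ (urgent-sub (exts s) u)

-- A variable cannot tick, so in a term that ticks 𝒰 never reaches a variable.
clock-urgent-sub⁻ : ∀ {m n i} (s : Fin m → Term n) {P P' : Term m} {α}
                  → Clock i P P' → α ∈U sub s P → α ∈U P
clock-urgent-sub⁻ s (c-pre a)    u-pre         = u-pre
clock-urgent-sub⁻ s (c-μ k)      (u-μ u)       = u-μ (clock-urgent-sub⁻ (exts s) k u)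
clock-urgent-sub⁻ s (c-∖ k)      (u-∖ u α∉L)   = u-∖ (clock-urgent-sub⁻ s k u) α∉L
clock-urgent-sub⁻ s (c-rel k)    (u-rel u)     = u-rel (clock-urgent-sub⁻ s k u)
clock-urgent-sub⁻ s (c-+ k k')   (u-+l u)      = u-+l (clock-urgent-sub⁻ s k u)
clock-urgent-sub⁻ s (c-+ k k')   (u-+r u)      = u-+r (clock-urgent-sub⁻ s k' u)
clock-urgent-sub⁻ s (c-∥ k k' _) (u-∥l u)      = u-∥l (clock-urgent-sub⁻ s k u)
clock-urgent-sub⁻ s (c-∥ k k' _) (u-∥r u)      = u-∥r (clock-urgent-sub⁻ s k' u)
clock-urgent-sub⁻ s (c-∥ k k' _) (u-∥τ a u u') = u-∥τ a (clock-urgent-sub⁻ s k u) (clock-urgent-sub⁻ s k' u')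

clock-sub : ∀ {m n i} (s : Fin m → Term n) {P P' : Term m} → Clock i P P' → Clock i (sub s P) (sub s P')
clock-sub s c-0             = c-0
clock-sub s (c-pre a)       = c-pre a
clock-sub s c-σ             = c-σ
clock-sub s (c-σ₂ k)        = c-σ₂ (clock-sub s k)
clock-sub {i = i} s (c-μ {P = P} {P' = P'} k) =
  subst (Clock i (μ (sub (exts s) P))) (sym (sub-[/0] s P' (μ P))) (c-μ (clock-sub (exts s) k))
clock-sub s (c-∖ k)         = c-∖ (clock-sub s k)
clock-sub s (c-rel k)       = c-rel (clock-sub s k)
clock-sub s (c-+ k k')      = c-+ (clock-sub s k) (clock-sub s k')
clock-sub s (c-∥ k k' no-τ) = c-∥ (clock-sub s k) (clock-sub s k') (no-τ ∘ clock-urgent-sub⁻ s (c-∥ k k' no-τ))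

clock-urgent : ∀ {n i} {P P' : Term n} {α} → Clock i P P' → α ∈U P → α ∈U P'
clock-urgent (c-pre a)       u-pre         = u-pre
clock-urgent (c-μ {P = P} k) (u-μ u)       = urgent-sub (single (μ P)) (clock-urgent k u)
clock-urgent (c-∖ k)         (u-∖ u α∉L)   = u-∖ (clock-urgent k u) α∉L
clock-urgent (c-rel k)       (u-rel u)     = u-rel (clock-urgent k u)
clock-urgent (c-+ k k')      (u-+l u)      = u-+l (clock-urgent k u)
clock-urgent (c-+ k k')      (u-+r u)      = u-+r (clock-urgent k' u)
clock-urgent (c-∥ k k' _)    (u-∥l u)      = u-∥l (clock-urgent k u)
clock-urgent (c-∥ k k' _)    (u-∥r u)      = u-∥r (clock-urgent k' u)
clock-urgent (c-∥ k k' _)    (u-∥τ a u u') = u-∥τ a (clock-urgent k u) (clock-urgent k' u')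

data Ahead : Term 0 → Term 0 → Set where
  ahead-refl  : ∀ {P} → Ahead P P
  ahead-trans : ∀ {P Q R} → Ahead P Q → Ahead Q R → Ahead P R
  ahead-tick  : ∀ {P P'} → Clock two P P' → Ahead P' P
  ahead-⊕     : ∀ {P P' Q Q'} → Ahead P Q → Ahead P' Q' → Ahead (P ⊕ P') (Q ⊕ Q')
  ahead-∥     : ∀ {P P' Q Q'} → Ahead P Q → Ahead P' Q' → Ahead (P ∥ P') (Q ∥ Q')
  ahead-∖     : ∀ {P Q L} → Ahead P Q → Ahead (P ∖ L) (Q ∖ L)
  ahead-[]ʳ   : ∀ {P Q f} → Ahead P Q → Ahead (P [ f ]ʳ) (Q [ f ]ʳ)

ahead-wf : ∀ {P Q} → Ahead P Q → WF Q → WF P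
ahead-wf ahead-refl          w        = w
ahead-wf (ahead-trans a a')  w        = ahead-wf a (ahead-wf a' w)
ahead-wf (ahead-tick k)      w        = wf-clock w k
ahead-wf (ahead-⊕ a a')      (w , w') = ahead-wf a w , ahead-wf a' w'
ahead-wf (ahead-∥ a a')      (w , w') = ahead-wf a w , ahead-wf a' w'
ahead-wf (ahead-∖ a)         w        = ahead-wf a w
ahead-wf (ahead-[]ʳ a)       w        = ahead-wf a w

-- Stated for all closed instances of an open term, since c-μ ticks the open body of μ.
clock-reflects-act-sub : ∀ {n} {P P' : Term n} → Clock two P P' → (s : Fin n → Term 0) → WF P → (∀ i → WF (s i))
                       → ∀ {α R'} → sub s P' —[ α ]→ R' → ∃ λ R → (sub s P —[ α ]→ R) × Ahead R' R
clock-reflects-act-sub (c-pre a)    s w        ws t           = _ , t , ahead-refl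
clock-reflects-act-sub c-σ          s w        ws t           = _ , a-σ t , ahead-refl
clock-reflects-act-sub (c-σ₂ k)     s w        ws t           with clock-reflects-act-sub k s w ws t
... | R , t' , a = R , a-σ t' , a
clock-reflects-act-sub (c-+ k k')   s (w , w') ws (a-+l t)    with clock-reflects-act-sub k s w ws t
... | R , t' , a = R , a-+l t' , a
clock-reflects-act-sub (c-+ k k')   s (w , w') ws (a-+r t)    with clock-reflects-act-sub k' s w' ws t
... | R , t' , a = R , a-+r t' , a
clock-reflects-act-sub (c-∥ k k' _) s (w , w') ws (a-∥l t)    with clock-reflects-act-sub k s w ws t
... | R , t' , a = _ , a-∥l t' , ahead-∥ a (ahead-tick (clock-sub s k'))
clock-reflects-act-sub (c-∥ k k' _) s (w , w') ws (a-∥r t)    with clock-reflects-act-sub k' s w' ws t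
... | R , t' , a = _ , a-∥r t' , ahead-∥ (ahead-tick (clock-sub s k)) a
clock-reflects-act-sub (c-∥ k k' _) s (w , w') ws (a-sync t u)
  with clock-reflects-act-sub k s w ws t | clock-reflects-act-sub k' s w' ws u
... | R , t' , a | R' , u' , a' = _ , a-sync t' u' , ahead-∥ a a'
clock-reflects-act-sub (c-∖ k)      s w        ws (a-∖ t α∉L) with clock-reflects-act-sub k s w ws t
... | R , t' , a = _ , a-∖ t' α∉L , ahead-∖ a
clock-reflects-act-sub (c-rel k)    s w        ws (a-rel t)   with clock-reflects-act-sub k s w ws t
... | R , t' , a = _ , a-rel t' , ahead-[]ʳ a
clock-reflects-act-sub (c-μ {P = P} {P' = P'} k) s (g₀ , w) ws {α} t
  with clock-reflects-act-sub k (sub s ∘ single (μ P)) w (λ i → wf-sub s (single (μ P) i) ws (wf-single (g₀ , w) i))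
         (subst (_—[ α ]→ _) (sub-sub s (single (μ P)) P') t)
... | R , t' , a =
  R , μ-unfold-act (wf-sub s (μ P) ws (g₀ , w)) (λ ()) (subst (_—[ α ]→ R) (sub-single s P (μ P)) t') , a

clock-preserves-act-sub : ∀ {n} {P P' : Term n} → Clock two P P' → (s : Fin n → Term 0)
                        → ∀ {α R} → sub s P —[ α ]→ R → ∃ λ R' → (sub s P' —[ α ]→ R') × Ahead R' R
clock-preserves-act-sub (c-pre a)    s t           = _ , t , ahead-refl
clock-preserves-act-sub c-σ          s (a-σ t)     = _ , t , ahead-refl
clock-preserves-act-sub (c-σ₂ k)     s (a-σ t)     = clock-preserves-act-sub k s t
clock-preserves-act-sub (c-+ k k')   s (a-+l t)    with clock-preserves-act-sub k s t
... | R' , t' , a = R' , a-+l t' , a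
clock-preserves-act-sub (c-+ k k')   s (a-+r t)    with clock-preserves-act-sub k' s t
... | R' , t' , a = R' , a-+r t' , a
clock-preserves-act-sub (c-∥ k k' _) s (a-∥l t)    with clock-preserves-act-sub k s t
... | R' , t' , a = _ , a-∥l t' , ahead-∥ a (ahead-tick (clock-sub s k'))
clock-preserves-act-sub (c-∥ k k' _) s (a-∥r t)    with clock-preserves-act-sub k' s t
... | R' , t' , a = _ , a-∥r t' , ahead-∥ (ahead-tick (clock-sub s k)) a
clock-preserves-act-sub (c-∥ k k' _) s (a-sync t u) with clock-preserves-act-sub k s t | clock-preserves-act-sub k' s u
... | R' , t' , a | R'' , u' , a' = _ , a-sync t' u' , ahead-∥ a a'
clock-preserves-act-sub (c-∖ k)      s (a-∖ t α∉L) with clock-preserves-act-sub k s t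
... | R' , t' , a = _ , a-∖ t' α∉L , ahead-∖ a
clock-preserves-act-sub (c-rel k)    s (a-rel t)   with clock-preserves-act-sub k s t
... | R' , t' , a = _ , a-rel t' , ahead-[]ʳ a
clock-preserves-act-sub (c-μ {P = P} {P' = P'} k) s {α} {R} t
  with clock-preserves-act-sub k (sub s ∘ single (μ P))
         (subst (_—[ α ]→ R) (sym (sub-single s P (μ P))) (μ-unfold-act⁻ t))
... | R' , t' , a = R' , subst (_—[ α ]→ R') (sym (sub-sub s (single (μ P)) P')) t' , a

clock-reflects-act : ∀ {P P' : Term 0} → Clock two P P' → WF P
                   → ∀ {α R'} → P' —[ α ]→ R' → ∃ λ R → (P —[ α ]→ R) × Ahead R' R
clock-reflects-act {P} {P'} k w {α} t
  with clock-reflects-act-sub k var w (λ _ → tt) (subst (_—[ α ]→ _) (sym (sub-id P')) t)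
... | R , t' , a = R , subst (_—[ α ]→ R) (sub-id P) t' , a

clock-preserves-act : ∀ {P P' : Term 0} → Clock two P P'
                    → ∀ {α R} → P —[ α ]→ R → ∃ λ R' → (P' —[ α ]→ R') × Ahead R' R
clock-preserves-act {P} {P'} k {α} t
  with clock-preserves-act-sub k var (subst (_—[ α ]→ _) (sym (sub-id P)) t)
... | R' , t' , a = R' , subst (_—[ α ]→ R') (sub-id P') t' , a

ahead-forth : ∀ {P Q} → Ahead P Q → WF Q
            → ∀ {α P'} → P —[ α ]→ P' → ∃ λ Q' → (Q —[ α ]→ Q') × Ahead P' Q'
ahead-forth ahead-refl         w        t            = _ , t , ahead-refl
ahead-forth (ahead-trans a b)  w        t            with ahead-forth a (ahead-wf b w) t
... | M' , t' , a' with ahead-forth b w t'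
... | Q' , t'' , b' = Q' , t'' , ahead-trans a' b'
ahead-forth (ahead-tick k)     w        t            = clock-reflects-act k w t
ahead-forth (ahead-⊕ a b)      (w , v)  (a-+l t)     with ahead-forth a w t
... | Q' , t' , a' = Q' , a-+l t' , a'
ahead-forth (ahead-⊕ a b)      (w , v)  (a-+r t)     with ahead-forth b v t
... | Q' , t' , b' = Q' , a-+r t' , b'
ahead-forth (ahead-∥ a b)      (w , v)  (a-∥l t)     with ahead-forth a w t
... | Q' , t' , a' = _ , a-∥l t' , ahead-∥ a' b
ahead-forth (ahead-∥ a b)      (w , v)  (a-∥r t)     with ahead-forth b v t
... | Q' , t' , b' = _ , a-∥r t' , ahead-∥ a b'
ahead-forth (ahead-∥ a b)      (w , v)  (a-sync t u) with ahead-forth a w t | ahead-forth b v u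
... | Q' , t' , a' | Q'' , u' , b' = _ , a-sync t' u' , ahead-∥ a' b'
ahead-forth (ahead-∖ a)        w        (a-∖ t α∉L)  with ahead-forth a w t
... | Q' , t' , a' = _ , a-∖ t' α∉L , ahead-∖ a'
ahead-forth (ahead-[]ʳ a)      w        (a-rel t)    with ahead-forth a w t
... | Q' , t' , a' = _ , a-rel t' , ahead-[]ʳ a'

ahead-back : ∀ {P Q} → Ahead P Q
           → ∀ {α Q'} → Q —[ α ]→ Q' → ∃ λ P' → (P —[ α ]→ P') × Ahead P' Q'
ahead-back ahead-refl        t            = _ , t , ahead-refl
ahead-back (ahead-trans a b) t            with ahead-back b t
... | M' , t' , b' with ahead-back a t'
... | P' , t'' , a' = P' , t'' , ahead-trans a' b'
ahead-back (ahead-tick k)    t            = clock-preserves-act k t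
ahead-back (ahead-⊕ a b)     (a-+l t)     with ahead-back a t
... | P' , t' , a' = P' , a-+l t' , a'
ahead-back (ahead-⊕ a b)     (a-+r t)     with ahead-back b t
... | P' , t' , b' = P' , a-+r t' , b'
ahead-back (ahead-∥ a b)     (a-∥l t)     with ahead-back a t
... | P' , t' , a' = _ , a-∥l t' , ahead-∥ a' b
ahead-back (ahead-∥ a b)     (a-∥r t)     with ahead-back b t
... | P' , t' , b' = _ , a-∥r t' , ahead-∥ a b'
ahead-back (ahead-∥ a b)     (a-sync t u) with ahead-back a t | ahead-back b u
... | P' , t' , a' | P'' , u' , b' = _ , a-sync t' u' , ahead-∥ a' b'
ahead-back (ahead-∖ a)       (a-∖ t α∉L)  with ahead-back a t
... | P' , t' , a' = _ , a-∖ t' α∉L , ahead-∖ a'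
ahead-back (ahead-[]ʳ a)     (a-rel t)    with ahead-back a t
... | P' , t' , a' = _ , a-rel t' , ahead-[]ʳ a'

⊆ᵘ-trans : ∀ {n} {P Q R : Term n} → P ⊆ᵘ Q → Q ⊆ᵘ R → P ⊆ᵘ R
⊆ᵘ-trans P⊆Q Q⊆R α = Q⊆R α ∘ P⊆Q α

⊕-mono-⊆ᵘ : ∀ {n} {P P' Q Q' : Term n} → P ⊆ᵘ P' → Q ⊆ᵘ Q' → (P ⊕ Q) ⊆ᵘ (P' ⊕ Q')
⊕-mono-⊆ᵘ P⊆P' Q⊆Q' α (u-+l u) = u-+l (P⊆P' α u)
⊕-mono-⊆ᵘ P⊆P' Q⊆Q' α (u-+r u) = u-+r (Q⊆Q' α u)

∥-mono-⊆ᵘ : ∀ {n} {P P' Q Q' : Term n} → P ⊆ᵘ P' → Q ⊆ᵘ Q' → (P ∥ Q) ⊆ᵘ (P' ∥ Q')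
∥-mono-⊆ᵘ P⊆P' Q⊆Q' α (u-∥l u)      = u-∥l (P⊆P' α u)
∥-mono-⊆ᵘ P⊆P' Q⊆Q' α (u-∥r u)      = u-∥r (Q⊆Q' α u)
∥-mono-⊆ᵘ P⊆P' Q⊆Q' τ (u-∥τ a u u') = u-∥τ a (P⊆P' _ u) (Q⊆Q' _ u')

∖-mono-⊆ᵘ : ∀ {n} {P P' : Term n} {L} → P ⊆ᵘ P' → (P ∖ L) ⊆ᵘ (P' ∖ L)
∖-mono-⊆ᵘ P⊆P' α (u-∖ u α∉L) = u-∖ (P⊆P' α u) α∉L

[]ʳ-mono-⊆ᵘ : ∀ {n} {P P' : Term n} {f} → P ⊆ᵘ P' → (P [ f ]ʳ) ⊆ᵘ (P' [ f ]ʳ)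
[]ʳ-mono-⊆ᵘ P⊆P' _ (u-rel u) = u-rel (P⊆P' _ u)

ahead-tick₂ : ∀ {P Q} → Ahead P Q
            → ∀ {P'} → Clock two P P' → Q ⊆ᵘ P × ∃ λ Q' → Clock two Q Q' × Ahead P' Q'
ahead-tick₂ ahead-refl        k              = (λ _ u → u) , _ , k , ahead-refl
ahead-tick₂ (ahead-trans a b) k              with ahead-tick₂ a k
... | M⊆P , M' , k' , a' with ahead-tick₂ b k'
... | Q⊆M , Q' , k'' , b' = ⊆ᵘ-trans Q⊆M M⊆P , Q' , k'' , ahead-trans a' b'
ahead-tick₂ (ahead-tick k₀)   k              = (λ _ → clock-urgent k₀) , _ , k₀ , ahead-tick k
ahead-tick₂ (ahead-⊕ a b)     (c-+ k l)      with ahead-tick₂ a k | ahead-tick₂ b l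
... | Q⊆P , Q' , k' , a' | R⊆S , R' , l' , b' = ⊕-mono-⊆ᵘ Q⊆P R⊆S , _ , c-+ k' l' , ahead-⊕ a' b'
ahead-tick₂ (ahead-∥ a b)     (c-∥ k l no-τ) with ahead-tick₂ a k | ahead-tick₂ b l
... | Q⊆P , Q' , k' , a' | R⊆S , R' , l' , b' =
  ∥-mono-⊆ᵘ Q⊆P R⊆S , _ , c-∥ k' l' (no-τ ∘ ∥-mono-⊆ᵘ Q⊆P R⊆S τ) , ahead-∥ a' b'
ahead-tick₂ (ahead-∖ a)       (c-∖ k)        with ahead-tick₂ a k
... | Q⊆P , Q' , k' , a' = ∖-mono-⊆ᵘ Q⊆P , _ , c-∖ k' , ahead-∖ a'
ahead-tick₂ (ahead-[]ʳ a)     (c-rel k)      with ahead-tick₂ a k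
... | Q⊆P , Q' , k' , a' = []ʳ-mono-⊆ᵘ Q⊆P , _ , c-rel k' , ahead-[]ʳ a'

clock₁⇒clock₂ : ∀ {n} {P P' : Term n} → Clock one P P' → Clock two P P'
clock₁⇒clock₂ c-0             = c-0
clock₁⇒clock₂ (c-pre a)       = c-pre a
clock₁⇒clock₂ c-σ             = c-σ
clock₁⇒clock₂ (c-μ k)         = c-μ (clock₁⇒clock₂ k)
clock₁⇒clock₂ (c-∖ k)         = c-∖ (clock₁⇒clock₂ k)
clock₁⇒clock₂ (c-rel k)       = c-rel (clock₁⇒clock₂ k)
clock₁⇒clock₂ (c-+ k k')      = c-+ (clock₁⇒clock₂ k) (clock₁⇒clock₂ k')
clock₁⇒clock₂ (c-∥ k k' no-τ) = c-∥ (clock₁⇒clock₂ k) (clock₁⇒clock₂ k') no-τ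

-- Where a σ₂-step passes through several σ-prefixes, the σ₁-step stops after the
-- first one; the rest of the σ₂-step then puts its result ahead of the σ₁-result.
clock₂⇒clock₁-sub : ∀ {n} {P P' : Term n} → Clock two P P'
                  → ∃ λ P₁ → Clock one P P₁ × (∀ (s : Fin n → Term 0) → Ahead (sub s P') (sub s P₁))
clock₂⇒clock₁-sub c-0       = _ , c-0 , λ _ → ahead-refl
clock₂⇒clock₁-sub (c-pre a) = _ , c-pre a , λ _ → ahead-refl
clock₂⇒clock₁-sub c-σ       = _ , c-σ , λ _ → ahead-refl
clock₂⇒clock₁-sub (c-σ₂ k)  = _ , c-σ , λ s → ahead-tick (clock-sub s k)
clock₂⇒clock₁-sub (c-μ {P = P} {P' = P'} k) with clock₂⇒clock₁-sub k
... | P₁ , k₁ , a = P₁ [ μ P /0] , c-μ k₁ , λ s →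
  subst₂ Ahead (sym (sub-sub s (single (μ P)) P')) (sym (sub-sub s (single (μ P)) P₁)) (a (sub s ∘ single (μ P)))
clock₂⇒clock₁-sub (c-∖ k)   with clock₂⇒clock₁-sub k
... | _ , k₁ , a = _ , c-∖ k₁ , ahead-∖ ∘ a
clock₂⇒clock₁-sub (c-rel k) with clock₂⇒clock₁-sub k
... | _ , k₁ , a = _ , c-rel k₁ , ahead-[]ʳ ∘ a
clock₂⇒clock₁-sub (c-+ k k') with clock₂⇒clock₁-sub k | clock₂⇒clock₁-sub k'
... | _ , k₁ , a | _ , k₁' , a' = _ , c-+ k₁ k₁' , λ s → ahead-⊕ (a s) (a' s)
clock₂⇒clock₁-sub (c-∥ k k' no-τ) with clock₂⇒clock₁-sub k | clock₂⇒clock₁-sub k'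
... | _ , k₁ , a | _ , k₁' , a' = _ , c-∥ k₁ k₁' no-τ , λ s → ahead-∥ (a s) (a' s)

clock₂⇒clock₁ : ∀ {P P' : Term 0} → Clock two P P' → ∃ λ P₁ → Clock one P P₁ × Ahead P' P₁
clock₂⇒clock₁ {P' = P'} k with clock₂⇒clock₁-sub k
... | P₁ , k₁ , a = P₁ , k₁ , subst₂ Ahead (sub-id P') (sub-id P₁) (a var)

_≽_ : Proc → Proc → Set
P ≽ Q = Ahead (proj₁ P) (proj₁ Q)

-- Relation.Binary.Construct.Composition._;_, which cannot be written since ; separates declarations.
_⨾_ : (Proc → Proc → Set) → (Proc → Proc → Set) → Proc → Proc → Set
(R ⨾ S) P Q = ∃ λ M → R P M × S M Q

Forth Back : (Proc → Proc → Set) → Proc → Proc → Set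
Forth R P Q = ∀ (α : Act) (P' : Proc) → proj₁ P —[ α ]→ proj₁ P'
            → ∃ λ (Q' : Proc) → (proj₁ Q —[ α ]→ proj₁ Q') × R P' Q'
Back R P Q  = ∀ (α : Act) (Q' : Proc) → proj₁ Q —[ α ]→ proj₁ Q'
            → ∃ λ (P' : Proc) → (proj₁ P —[ α ]→ proj₁ P') × R P' Q'

Tick : Idx → (Proc → Proc → Set) → Proc → Proc → Set
Tick i R P Q = ∀ (P' : Proc) → Clock i (proj₁ P) (proj₁ P')
             → proj₁ Q ⊆ᵘ proj₁ P × ∃ λ (Q' : Proc) → Clock i (proj₁ Q) (proj₁ Q') × R P' Q'

module _ {i} {R : Proc → Proc → Set} (R-faster : IsFasterThan i R) (P Q : Proc) (PRQ : R P Q) where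

  forth : Forth R P Q
  forth = proj₁ (R-faster P Q PRQ)

  back : Back R P Q
  back = proj₁ (proj₂ (R-faster P Q PRQ))

  tick : Tick i R P Q
  tick = proj₂ (proj₂ (R-faster P Q PRQ))

composite-forth : ∀ {i j R S} → IsFasterThan i R → IsFasterThan j S
                → ∀ P Q → (R ⨾ S) P Q → Forth (R ⨾ S) P Q
composite-forth R-faster S-faster P Q (M , PRM , MSQ) α P' P→P' =
  let M' , M→M' , P'RM' = forth R-faster P M PRM α P' P→P'
      Q' , Q→Q' , M'SQ' = forth S-faster M Q MSQ α M' M→M'
  in Q' , Q→Q' , M' , P'RM' , M'SQ'

composite-back : ∀ {i j R S} → IsFasterThan i R → IsFasterThan j S
               → ∀ P Q → (R ⨾ S) P Q → Back (R ⨾ S) P Q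
composite-back R-faster S-faster P Q (M , PRM , MSQ) α Q' Q→Q' =
  let M' , M→M' , M'SQ' = back S-faster M Q MSQ α Q' Q→Q'
      P' , P→P' , P'RM' = back R-faster P M PRM α M' M→M'
  in P' , P→P' , M' , P'RM' , M'SQ'

≽-faster₂ : IsFasterThan two _≽_
≽-faster₂ (P , wP) (Q , wQ) P≽Q = forth′ , back′ , tick′
  where
  forth′ : Forth _≽_ (P , wP) (Q , wQ)
  forth′ α P' P→P' =
    let Q' , Q→Q' , P'≽Q' = ahead-forth P≽Q wQ P→P' in (Q' , wf-act wQ Q→Q') , Q→Q' , P'≽Q'
  back′ : Back _≽_ (P , wP) (Q , wQ)
  back′ α Q' Q→Q' =
    let P' , P→P' , P'≽Q' = ahead-back P≽Q Q→Q' in (P' , wf-act wP P→P') , P→P' , P'≽Q'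
  tick′ : Tick two _≽_ (P , wP) (Q , wQ)
  tick′ P' P→P' =
    let Q⊆P , Q' , Q→Q' , P'≽Q' = ahead-tick₂ P≽Q P→P' in Q⊆P , (Q' , wf-clock wQ Q→Q') , Q→Q' , P'≽Q'

≽-clock₂⇒clock₁ : ∀ (P P' : Proc) → Clock two (proj₁ P) (proj₁ P')
                → ∃ λ (P₁ : Proc) → Clock one (proj₁ P) (proj₁ P₁) × P' ≽ P₁
≽-clock₂⇒clock₁ (P , wP) P' k =
  let P₁ , k₁ , P'≽P₁ = clock₂⇒clock₁ k in (P₁ , wf-clock wP k₁) , k₁ , P'≽P₁

≽⨾-faster₂ : ∀ {R} → IsFasterThan one R → IsFasterThan two (_≽_ ⨾ R)
≽⨾-faster₂ {R} R-faster A B A≽RB@(A₀ , A≽A₀ , A₀RB) =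
  composite-forth ≽-faster₂ R-faster A B A≽RB , composite-back ≽-faster₂ R-faster A B A≽RB , tick′
  where
  tick′ : Tick two (_≽_ ⨾ R) A B
  tick′ A' A→A' =
    let A₀⊆A , X , A₀→X , A'≽X     = tick ≽-faster₂ A A₀ A≽A₀ A' A→A'
        X₁ , A₀→₁X₁ , X≽X₁         = ≽-clock₂⇒clock₁ A₀ X A₀→X
        B⊆A₀ , B' , B→₁B' , X₁RB'  = tick R-faster A₀ B A₀RB X₁ A₀→₁X₁
    in ⊆ᵘ-trans B⊆A₀ A₀⊆A , B' , clock₁⇒clock₂ B→₁B' , X₁ , ahead-trans A'≽X X≽X₁ , X₁RB'

⨾≽-faster₁ : ∀ {R} → IsFasterThan two R → IsFasterThan one (R ⨾ _≽_)
⨾≽-faster₁ {R} R-faster A B AR≽B@(B₀ , ARB₀ , B₀≽B) =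
  composite-forth R-faster ≽-faster₂ A B AR≽B , composite-back R-faster ≽-faster₂ A B AR≽B , tick′
  where
  tick′ : Tick one (R ⨾ _≽_) A B
  tick′ A' A→₁A' =
    let B₀⊆A , B₀' , B₀→B₀' , A'RB₀' = tick R-faster A B₀ ARB₀ A' (clock₁⇒clock₂ A→₁A')
        B⊆B₀ , Y , B→Y , B₀'≽Y       = tick ≽-faster₂ B₀ B B₀≽B B₀' B₀→B₀'
        Y₁ , B→₁Y₁ , Y≽Y₁            = ≽-clock₂⇒clock₁ B Y B→Y
    in ⊆ᵘ-trans B⊆B₀ B₀⊆A , Y₁ , B→₁Y₁ , B₀' , A'RB₀' , ahead-trans B₀'≽Y Y≽Y₁

⊒₁⇒⊒₂ : ∀ {P Q} → P ⊒[ one ] Q → P ⊒[ two ] Q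
⊒₁⇒⊒₂ {P} (R , R-faster , PRQ) = (_≽_ ⨾ R) , ≽⨾-faster₂ R-faster , P , ahead-refl , PRQ

⊒₂⇒⊒₁ : ∀ {P Q} → P ⊒[ two ] Q → P ⊒[ one ] Q
⊒₂⇒⊒₁ {Q = Q} (R , R-faster , PRQ) = (R ⨾ _≽_) , ⨾≽-faster₁ R-faster , Q , PRQ , ahead-refl

theorem17 : ∀ (P Q : Proc) → (P ⊒[ one ] Q → P ⊒[ two ] Q) × (P ⊒[ two ] Q → P ⊒[ one ] Q)
theorem17 P Q = ⊒₁⇒⊒₂ , ⊒₂⇒⊒₁
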